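{- Let $B$ be a complete Boolean algebra. (a) For every set $A\subseteq B$, $\mathrm{cl}(A)=\bigcap\{A\vartriangle V: V\in\mathcal N_0\}$, where $A\vartriangle V=\{a\vartriangle v: a\in A, v\in V\}$. (b) If $(B,\tau_s)$ is Fréchet and $A$ is downward closed, then $\mathrm{cl}(A)=\bigcap\{A\vee V: V\in\mathcal N_0^d\}$, where $A\vee V=\{a\vee v:a\in A,v\in V\}$, and $\mathrm{cl}(A)$ is downward closed.
   Context: For a sequence $\langle b_n\rangle$ in $B$, let $\overline{\lim}\, b_n=\bigwedge_k\bigvee_{n\ge k}b_n$ and $\underline{\lim}\, b_n=\bigvee_k\bigwedge_{n\ge k}b_n$; the sequence algebraically converges to $b$ if both equal $b$. The sequential topology $\tau_s$ on $B$ is the largest topology on $B$ in which every algebraically convergent sequence converges to its algebraic limit; $\mathrm{cl}$ is closure in $\tau_s$. $\mathcal N_0$ is the set of all $\tau_s$-neighborhoods of $\mathbf 0$ and $\mathcal N_0^d$ is the set of those members of $\mathcal N_0$ that are downward closed (a set $S$ is downward closed if $a<d\in S$ implies $a\in S$). A space is Fréchet if the closure of every set is the set of limits of sequences from it. $\vartriangle$ is symmetric difference. -}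

module Defs where

open import Level using (Level; _⊔_) renaming (suc to lsuc)
open import Data.Nat using (ℕ; _≥_)
open import Data.Product using (Σ; ∃; ∃-syntax; _×_; _,_)
open import Relation.Binary.PropositionalEquality using (_≡_; _≢_)
open import Relation.Unary using (Pred; _∈_; _⊆_; _≐_; ∁)
open import Algebra.Core using (Op₁; Op₂)
open import Algebra.Lattice.Structures using (IsBooleanAlgebra)

record CompleteBooleanAlgebra (a : Level) : Set (lsuc a) where
  infixr 6 _∨_
  infixr 7 _∧_
  field
    Carrier : Set a
    _∨_ : Op₂ Carrier
    _∧_ : Op₂ Carrier
    ¬_ : Op₁ Carrier
    ⊤ : Carrier
    ⊥ : Carrier
    isBooleanAlgebra : IsBooleanAlgebra _≡_ _∨_ _∧_ ¬_ ⊤ ⊥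

  _≤_ : Carrier → Carrier → Set a
  x ≤ y = x ∧ y ≡ x

  _<_ : Carrier → Carrier → Set a
  x < y = (x ≤ y) × (x ≢ y)

  field
    ⋁ : Pred Carrier a → Carrier
    ⋁-upper : ∀ (S : Pred Carrier a) {x} → S x → x ≤ ⋁ S
    ⋁-least : ∀ (S : Pred Carrier a) {y} → (∀ {x} → S x → x ≤ y) → ⋁ S ≤ y

  ⋀ : Pred Carrier a → Carrier
  ⋀ S = ⋁ (λ y → ∀ {x} → S x → y ≤ x)

  _△_ : Op₂ Carrier
  x △ y = (x ∧ ¬ y) ∨ (y ∧ ¬ x)

  tailSet : (ℕ → Carrier) → ℕ → Pred Carrier a
  tailSet b k x = ∃[ n ] (n ≥ k × x ≡ b n)

  limSup : (ℕ → Carrier) → Carrier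
  limSup b = ⋀ (λ x → ∃[ k ] (x ≡ ⋁ (tailSet b k)))

  limInf : (ℕ → Carrier) → Carrier
  limInf b = ⋁ (λ x → ∃[ k ] (x ≡ ⋀ (tailSet b k)))

  AlgConverges : (ℕ → Carrier) → Carrier → Set a
  AlgConverges b x = (limSup b ≡ x) × (limInf b ≡ x)

  record IsTopology (T : Pred (Pred Carrier a) a) : Set (lsuc a) where
    field
      univ-open : T (λ _ → Carrier)
      ∪-open : (I : Set a) (U : I → Pred Carrier a) → (∀ i → T (U i)) →
               T (λ x → ∃[ i ] U i x)
      ∩-open : ∀ U V → T U → T V → T (λ x → U x × V x)
      ≐-open : ∀ U V → U ≐ V → T U → T V

  ConvergesIn : Pred (Pred Carrier a) a → (ℕ → Carrier) → Carrier → Set (lsuc a)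
  ConvergesIn T b x = ∀ U → T U → U x → ∃[ k ] (∀ n → n ≥ k → U (b n))

  Admissible : Pred (Pred Carrier a) a → Set (lsuc a)
  Admissible T = IsTopology T × (∀ b x → AlgConverges b x → ConvergesIn T b x)

  -- τ_s: the largest admissible topology, i.e. a set is τ_s-open iff it is
  -- open in some admissible topology
  IsOpen : Pred (Pred Carrier a) (lsuc a)
  IsOpen O = ∃[ T ] (Admissible T × T O)

  IsClosed : Pred (Pred Carrier a) (lsuc a)
  IsClosed C = IsOpen (∁ C)

  cl : Pred Carrier a → Pred Carrier (lsuc a)
  cl A x = ∀ C → IsClosed C → A ⊆ C → C x

  Converges : (ℕ → Carrier) → Carrier → Set (lsuc a)
  Converges b x = ∀ U → IsOpen U → U x → ∃[ k ] (∀ n → n ≥ k → U (b n))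

  seqLimits : Pred Carrier a → Pred Carrier (lsuc a)
  seqLimits A x = ∃[ b ] ((∀ n → A (b n)) × Converges b x)

  Frechet : Set (lsuc a)
  Frechet = ∀ (A : Pred Carrier a) → cl A ≐ seqLimits A

  𝒩₀ : Pred (Pred Carrier a) (lsuc a)
  𝒩₀ V = ∃[ O ] (IsOpen O × O ⊥ × O ⊆ V)

  DownClosed : ∀ {ℓ} → Pred Carrier ℓ → Set (a ⊔ ℓ)
  DownClosed S = ∀ {x d} → x < d → S d → S x

  𝒩₀ᵈ : Pred (Pred Carrier a) (lsuc a)
  𝒩₀ᵈ V = 𝒩₀ V × DownClosed V

  _△ˢ_ : Pred Carrier a → Pred Carrier a → Pred Carrier a
  (A △ˢ V) x = ∃[ p ] ∃[ v ] (A p × V v × x ≡ p △ v)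

  _∨ˢ_ : Pred Carrier a → Pred Carrier a → Pred Carrier a
  (A ∨ˢ V) x = ∃[ p ] ∃[ v ] (A p × V v × x ≡ p ∨ v)

  ⋂[_]_ : Pred (Pred Carrier a) (lsuc a) → (Pred Carrier a → Pred Carrier a) →
          Pred Carrier (lsuc a)
  (⋂[ 𝒩 ] F) x = ∀ V → 𝒩 V → F V x

-- Translations y ↦ y △ x preserve algebraic convergence, and a set is τ_s-open exactly
-- when it is sequentially open for algebraic convergence; hence translations are
-- homeomorphisms of τ_s. So x ∉ cl A iff some open O ∋ 𝟘 avoids every p △ x with p ∈ A,
-- i.e. iff x ∉ A △ O, which gives (a).
-- For downward closed A, an element x = p △ v is also (p ∧ x) ∨ (¬ p ∧ x) with p ∧ x ≤ p
-- and ¬ p ∧ x ≤ v. Conversely, if x lies outside a closed C ⊇ A, the set V of those v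
-- admitting some u ≤ x ∧ ¬ v outside C is a downward closed neighbourhood of 𝟘 (it is open
-- because u ∧ ¬ bₙ converges to u ∧ ¬ v = u whenever bₙ converges to v), and x ∉ A ∨ V.
-- Downward closedness of cl A is inherited from the sets A ∨ V.

module Submission where

open import Defs
open import Level using (Level; lift; lower) renaming (suc to lsuc)
open import Function using (id; _∘_)
open import Data.Product using (_×_; _,_; ∃-syntax)
open import Data.Nat using (ℕ; _≥_; _+_; _⊔_)
open import Data.Nat.Properties using (m≤m+n; m≤n+m; m≤m⊔n; m≤n⊔m)
import Data.Nat.Properties as ℕ
open import Relation.Nullary using (Dec; yes; no; Stable) renaming (¬_ to Not)
open import Relation.Nullary.Decidable using (map′; decidable-stable)
open import Relation.Unary using (Pred; _≐_; _⊆_; ∁)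
open import Relation.Binary.PropositionalEquality
  using (_≡_; refl; sym; trans; cong; cong₂; subst; module ≡-Reasoning)
open import Axiom.ExcludedMiddle using (ExcludedMiddle)
open import Algebra.Lattice.Bundles using (BooleanAlgebra)
import Algebra.Lattice.Properties.BooleanAlgebra as BooleanAlgebraProperties
import Algebra.Lattice.Properties.Lattice as LatticeProperties
import Relation.Binary.Lattice as OrderTheoretic

module Order {a : Level} (B : CompleteBooleanAlgebra a) where
  open CompleteBooleanAlgebra B renaming (_≤_ to infix 4 _≤_)

  private
    booleanAlgebra : BooleanAlgebra a a
    booleanAlgebra = record { isBooleanAlgebra = isBooleanAlgebra }

    -- The library orders a lattice by x ≈ x ∧ y, the converse of the equation used here.
    module ≤ₗ = OrderTheoretic.Lattice
      (LatticeProperties.∨-∧-orderTheoreticLattice (BooleanAlgebra.lattice booleanAlgebra))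

  open BooleanAlgebra booleanAlgebra public
    using (∧-comm; ∨-comm; ∧-distribˡ-∨; ∧-distribʳ-∨; ∧-complementʳ; ∨-complementʳ)
  open BooleanAlgebraProperties booleanAlgebra public
    using (∧-identityˡ; ∧-identityʳ; ∨-identityˡ; ∨-identityʳ; ¬⊥≈⊤; ¬-involutive; deMorgan₁; deMorgan₂)
  open BooleanAlgebraProperties booleanAlgebra using (module XorRing)

  ≤-refl : ∀ {x} → x ≤ x
  ≤-refl = sym ≤ₗ.refl

  ≤-reflexive : ∀ {x y} → x ≡ y → x ≤ y
  ≤-reflexive refl = ≤-refl

  ≤-trans : ∀ {x y z} → x ≤ y → y ≤ z → x ≤ z
  ≤-trans p q = sym (≤ₗ.trans (sym p) (sym q))

  ≤-antisym : ∀ {x y} → x ≤ y → y ≤ x → x ≡ y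
  ≤-antisym p q = ≤ₗ.antisym (sym p) (sym q)

  x∧y≤x : ∀ x y → x ∧ y ≤ x
  x∧y≤x x y = sym (≤ₗ.x∧y≤x x y)

  x∧y≤y : ∀ x y → x ∧ y ≤ y
  x∧y≤y x y = sym (≤ₗ.x∧y≤y x y)

  ∧-greatest : ∀ {x y z} → z ≤ x → z ≤ y → z ≤ x ∧ y
  ∧-greatest p q = sym (≤ₗ.∧-greatest (sym p) (sym q))

  x≤x∨y : ∀ x y → x ≤ x ∨ y
  x≤x∨y x y = sym (≤ₗ.x≤x∨y x y)

  y≤x∨y : ∀ x y → y ≤ x ∨ y
  y≤x∨y x y = sym (≤ₗ.y≤x∨y x y)

  ∨-least : ∀ {x y z} → x ≤ z → y ≤ z → x ∨ y ≤ z
  ∨-least p q = sym (≤ₗ.∨-least (sym p) (sym q))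

  ∧-monoʳ-≤ : ∀ c {x y} → x ≤ y → c ∧ x ≤ c ∧ y
  ∧-monoʳ-≤ c {x} p = ∧-greatest (x∧y≤x c x) (≤-trans (x∧y≤y c x) p)

  ∨-absorbs-≤ : ∀ {x y} → x ≤ y → y ∨ x ≡ y
  ∨-absorbs-≤ {x} {y} x≤y = ≤-antisym (∨-least ≤-refl x≤y) (x≤x∨y y x)

  ¬-antimono-≤ : ∀ {x y} → x ≤ y → ¬ y ≤ ¬ x
  ¬-antimono-≤ {x} {y} x≤y = trans (sym (deMorgan₂ y x)) (cong ¬_ (∨-absorbs-≤ x≤y))

  x≤¬y⇒y≤¬x : ∀ {x y} → x ≤ ¬ y → y ≤ ¬ x
  x≤¬y⇒y≤¬x {x} {y} p = subst (_≤ ¬ x) (¬-involutive y) (¬-antimono-≤ p)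

  ¬x≤y⇒¬y≤x : ∀ {x y} → ¬ x ≤ y → ¬ y ≤ x
  ¬x≤y⇒¬y≤x {x} {y} p = subst (¬ y ≤_) (¬-involutive x) (¬-antimono-≤ p)

  x≡[c∧x]∨[¬c∧x] : ∀ c x → x ≡ (c ∧ x) ∨ (¬ c ∧ x)
  x≡[c∧x]∨[¬c∧x] c x = begin
    x                   ≡⟨ sym (∧-identityˡ x) ⟩
    ⊤ ∧ x               ≡⟨ cong (_∧ x) (sym (∨-complementʳ c)) ⟩
    (c ∨ ¬ c) ∧ x       ≡⟨ ∧-distribʳ-∨ x c (¬ c) ⟩
    (c ∧ x) ∨ (¬ c ∧ x) ∎
    where open ≡-Reasoning

  ∧≤⇒≤¬∨ : ∀ {c s y} → c ∧ s ≤ y → s ≤ ¬ c ∨ y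
  ∧≤⇒≤¬∨ {c} {s} {y} c∧s≤y = subst (_≤ ¬ c ∨ y) (sym (x≡[c∧x]∨[¬c∧x] c s))
    (∨-least (≤-trans c∧s≤y (y≤x∨y (¬ c) y)) (≤-trans (x∧y≤x (¬ c) s) (x≤x∨y (¬ c) y)))

  ≤¬∨⇒∧≤ : ∀ {c s y} → s ≤ ¬ c ∨ y → c ∧ s ≤ y
  ≤¬∨⇒∧≤ {c} {s} {y} s≤¬c∨y =
    ≤-trans (∧-monoʳ-≤ c s≤¬c∨y) (≤-trans (≤-reflexive c∧[¬c∨y]≡c∧y) (x∧y≤y c y))
    where
    open ≡-Reasoning
    c∧[¬c∨y]≡c∧y : c ∧ (¬ c ∨ y) ≡ c ∧ y
    c∧[¬c∨y]≡c∧y = begin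
      c ∧ (¬ c ∨ y)       ≡⟨ ∧-distribˡ-∨ c (¬ c) y ⟩
      (c ∧ ¬ c) ∨ (c ∧ y) ≡⟨ cong (_∨ (c ∧ y)) (∧-complementʳ c) ⟩
      ⊥ ∨ (c ∧ y)         ≡⟨ ∨-identityˡ (c ∧ y) ⟩
      c ∧ y               ∎

  ≤∨⇒¬∧≤ : ∀ {s x y} → s ≤ x ∨ y → ¬ x ∧ s ≤ y
  ≤∨⇒¬∧≤ {s} {x} {y} s≤x∨y = ≤¬∨⇒∧≤ (subst (λ w → s ≤ w ∨ y) (sym (¬-involutive x)) s≤x∨y)

  x≤¬⊥ : ∀ x → x ≤ ¬ ⊥
  x≤¬⊥ x = subst (x ≤_) (sym ¬⊥≈⊤) (∧-identityʳ x)

  x△y≤x∨y : ∀ x y → x △ y ≤ x ∨ y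
  x△y≤x∨y x y = ∨-least (≤-trans (x∧y≤x x (¬ y)) (x≤x∨y x y))
                        (≤-trans (x∧y≤x y (¬ x)) (y≤x∨y x y))

  △-def : ∀ x y → x △ y ≡ (x ∨ y) ∧ ¬ (x ∧ y)
  △-def x y = sym (begin
    (x ∨ y) ∧ ¬ (x ∧ y)                             ≡⟨ cong ((x ∨ y) ∧_) (deMorgan₁ x y) ⟩
    (x ∨ y) ∧ (¬ x ∨ ¬ y)                           ≡⟨ ∧-distribʳ-∨ (¬ x ∨ ¬ y) x y ⟩
    (x ∧ (¬ x ∨ ¬ y)) ∨ (y ∧ (¬ x ∨ ¬ y))           ≡⟨ cong₂ _∨_ (∧-distribˡ-∨ x (¬ x) (¬ y))
                                                                 (∧-distribˡ-∨ y (¬ x) (¬ y)) ⟩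
    ((x ∧ ¬ x) ∨ (x ∧ ¬ y)) ∨ ((y ∧ ¬ x) ∨ (y ∧ ¬ y)) ≡⟨ cong₂ _∨_ (cong (_∨ (x ∧ ¬ y)) (∧-complementʳ x))
                                                                 (cong ((y ∧ ¬ x) ∨_) (∧-complementʳ y)) ⟩
    (⊥ ∨ (x ∧ ¬ y)) ∨ ((y ∧ ¬ x) ∨ ⊥)               ≡⟨ cong₂ _∨_ (∨-identityˡ _) (∨-identityʳ _) ⟩
    (x ∧ ¬ y) ∨ (y ∧ ¬ x)                           ∎)
    where open ≡-Reasoning

  open XorRing _△_ △-def public
    using () renaming (⊕-comm to △-comm; ⊕-assoc to △-assoc;
                       ⊕-identityˡ to △-identityˡ; ⊕-inverseˡ to x△x≡⊥)

  x△[x△y]≡y : ∀ x y → x △ (x △ y) ≡ y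
  x△[x△y]≡y x y = begin
    x △ (x △ y) ≡⟨ sym (△-assoc x x y) ⟩
    (x △ x) △ y ≡⟨ cong (_△ y) (x△x≡⊥ x) ⟩
    ⊥ △ y       ≡⟨ △-identityˡ y ⟩
    y           ∎
    where open ≡-Reasoning

  ⋀-lower : ∀ (S : Pred Carrier a) {x} → S x → ⋀ S ≤ x
  ⋀-lower S x∈S = ⋁-least _ (λ lowerBound → lowerBound x∈S)

  ⋀-greatest : ∀ (S : Pred Carrier a) {y} → (∀ {x} → S x → y ≤ x) → y ≤ ⋀ S
  ⋀-greatest S = ⋁-upper _

  -- Infinite distributivity, which in a Boolean algebra reduces to residuation.
  ∧-⋁-least : ∀ (S : Pred Carrier a) c {y} → (∀ {s} → S s → c ∧ s ≤ y) → c ∧ ⋁ S ≤ y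
  ∧-⋁-least S c h = ≤¬∨⇒∧≤ (⋁-least S (∧≤⇒≤¬∨ ∘ h))

  ⋁-∧-least : ∀ (S : Pred Carrier a) c {y} → (∀ {s} → S s → s ∧ c ≤ y) → ⋁ S ∧ c ≤ y
  ⋁-∧-least S c {y} h =
    subst (_≤ y) (∧-comm c (⋁ S)) (∧-⋁-least S c (λ {s} s∈S → subst (_≤ y) (∧-comm s c) (h s∈S)))

module AlgebraicLimits {a : Level} (B : CompleteBooleanAlgebra a) where
  open CompleteBooleanAlgebra B renaming (_≤_ to infix 4 _≤_)
  open Order B

  tailSup : (ℕ → Carrier) → ℕ → Carrier
  tailSup b k = ⋁ (tailSet b k)

  tailInf : (ℕ → Carrier) → ℕ → Carrier
  tailInf b k = ⋀ (tailSet b k)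

  ≤tailSup : ∀ b {k n} → n ≥ k → b n ≤ tailSup b k
  ≤tailSup b n≥k = ⋁-upper _ (_ , n≥k , refl)

  tailSup-least : ∀ b {k y} → (∀ n → n ≥ k → b n ≤ y) → tailSup b k ≤ y
  tailSup-least b {y = y} h = ⋁-least _ (λ { (n , n≥k , refl) → h n n≥k })

  tailInf≤ : ∀ b {k n} → n ≥ k → tailInf b k ≤ b n
  tailInf≤ b n≥k = ⋀-lower _ (_ , n≥k , refl)

  tailInf-greatest : ∀ b {k y} → (∀ n → n ≥ k → y ≤ b n) → y ≤ tailInf b k
  tailInf-greatest b {y = y} h = ⋀-greatest _ (λ { (n , n≥k , refl) → h n n≥k })

  limSup≤tailSup : ∀ b k → limSup b ≤ tailSup b k
  limSup≤tailSup b k = ⋀-lower _ (k , refl)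

  limSup-greatest : ∀ b {y} → (∀ k → y ≤ tailSup b k) → y ≤ limSup b
  limSup-greatest b h = ⋀-greatest _ (λ { (k , refl) → h k })

  tailInf≤limInf : ∀ b k → tailInf b k ≤ limInf b
  tailInf≤limInf b k = ⋁-upper _ (k , refl)

  limInf-least : ∀ b {y} → (∀ k → tailInf b k ≤ y) → limInf b ≤ y
  limInf-least b h = ⋁-least _ (λ { (k , refl) → h k })

  limInf≤limSup : ∀ b → limInf b ≤ limSup b
  limInf≤limSup b = limInf-least b λ k → limSup-greatest b λ j →
    ≤-trans (tailInf≤ b (m≤m+n k j)) (≤tailSup b (m≤n+m j k))

  limSup-mono : ∀ {b c} → (∀ n → b n ≤ c n) → limSup b ≤ limSup c
  limSup-mono {b} {c} b≤c = limSup-greatest c λ k →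
    ≤-trans (limSup≤tailSup b k) (tailSup-least b (λ n n≥k → ≤-trans (b≤c n) (≤tailSup c n≥k)))

  limInf-mono : ∀ {b c} → (∀ n → b n ≤ c n) → limInf b ≤ limInf c
  limInf-mono {b} {c} b≤c = limInf-least b λ k →
    ≤-trans (tailInf-greatest c (λ n n≥k → ≤-trans (tailInf≤ b n≥k) (b≤c n))) (tailInf≤limInf c k)

  tailInf-∧ : ∀ f g k j → tailInf f k ∧ tailInf g j ≤ tailInf (λ n → f n ∧ g n) (k + j)
  tailInf-∧ f g k j = tailInf-greatest _ λ n n≥k+j →
    ∧-greatest (≤-trans (x∧y≤x _ _) (tailInf≤ f (ℕ.≤-trans (m≤m+n k j) n≥k+j)))
               (≤-trans (x∧y≤y _ _) (tailInf≤ g (ℕ.≤-trans (m≤n+m j k) n≥k+j)))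

  limInf-∧ : ∀ f g → limInf f ∧ limInf g ≤ limInf (λ n → f n ∧ g n)
  limInf-∧ f g =
    ⋁-∧-least _ (limInf g) λ { (k , refl) →
    ∧-⋁-least _ (tailInf f k) λ { (j , refl) →
    ≤-trans (tailInf-∧ f g k j) (tailInf≤limInf _ (k + j)) } }

  limSup-¬ : ∀ b → limSup (λ n → ¬ b n) ≤ ¬ limInf b
  limSup-¬ b = x≤¬y⇒y≤¬x (limInf-least b λ k → x≤¬y⇒y≤¬x
    (≤-trans (limSup≤tailSup _ k) (tailSup-least _ (λ n n≥k → ¬-antimono-≤ (tailInf≤ b n≥k)))))

  ¬limSup≤limInf-¬ : ∀ b → ¬ limSup b ≤ limInf (λ n → ¬ b n)
  ¬limSup≤limInf-¬ b = ¬x≤y⇒¬y≤x (limSup-greatest b λ k → ¬x≤y⇒¬y≤x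
    (≤-trans (tailInf-greatest _ (λ n n≥k → ¬-antimono-≤ (≤tailSup b n≥k))) (tailInf≤limInf _ k)))

  -- As limInf ≤ limSup always holds, each half of AlgConverges may be weakened to an inequality.
  Squeezed : (ℕ → Carrier) → Carrier → Set a
  Squeezed b z = limSup b ≤ z × z ≤ limInf b

  algConverges⇒squeezed : ∀ {b z} → AlgConverges b z → Squeezed b z
  algConverges⇒squeezed (limSup≡z , limInf≡z) = ≤-reflexive limSup≡z , ≤-reflexive (sym limInf≡z)

  squeezed⇒algConverges : ∀ {b z} → Squeezed b z → AlgConverges b z
  squeezed⇒algConverges {b} (limSup≤z , z≤limInf) =
    ≤-antisym limSup≤z (≤-trans z≤limInf (limInf≤limSup b)) ,
    ≤-antisym (≤-trans (limInf≤limSup b) limSup≤z) z≤limInf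

  squeezed-const : ∀ c → Squeezed (λ _ → c) c
  squeezed-const c = ≤-trans (limSup≤tailSup _ 0) (tailSup-least _ (λ _ _ → ≤-refl)) ,
                     ≤-trans (tailInf-greatest _ (λ _ _ → ≤-refl)) (tailInf≤limInf _ 0)

  squeezed-cong : ∀ {b c z} → (∀ n → b n ≡ c n) → Squeezed b z → Squeezed c z
  squeezed-cong b≡c (limSup≤z , z≤limInf) =
    ≤-trans (limSup-mono (λ n → ≤-reflexive (sym (b≡c n)))) limSup≤z ,
    ≤-trans z≤limInf (limInf-mono (λ n → ≤-reflexive (b≡c n)))

  squeezed-∧ : ∀ {f g x y} → Squeezed f x → Squeezed g y → Squeezed (λ n → f n ∧ g n) (x ∧ y)
  squeezed-∧ {f} {g} {x} {y} (f₁ , f₂) (g₁ , g₂) =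
    ∧-greatest (≤-trans (limSup-mono (λ n → x∧y≤x (f n) (g n))) f₁)
               (≤-trans (limSup-mono (λ n → x∧y≤y (f n) (g n))) g₁) ,
    ≤-trans (∧-greatest (≤-trans (x∧y≤x x y) f₂) (≤-trans (x∧y≤y x y) g₂)) (limInf-∧ f g)

  squeezed-¬ : ∀ {b z} → Squeezed b z → Squeezed (λ n → ¬ b n) (¬ z)
  squeezed-¬ {b} (limSup≤z , z≤limInf) =
    ≤-trans (limSup-¬ b) (¬-antimono-≤ z≤limInf) , ≤-trans (¬-antimono-≤ limSup≤z) (¬limSup≤limInf-¬ b)

  squeezed-∨ : ∀ {f g x y} → Squeezed f x → Squeezed g y → Squeezed (λ n → f n ∨ g n) (x ∨ y)
  squeezed-∨ {x = x} {y} f⇝x g⇝y = subst (Squeezed _) (¬[¬x∧¬y]≡x∨y x y)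
    (squeezed-cong (λ n → ¬[¬x∧¬y]≡x∨y _ _) (squeezed-¬ (squeezed-∧ (squeezed-¬ f⇝x) (squeezed-¬ g⇝y))))
    where
    ¬[¬x∧¬y]≡x∨y : ∀ x y → ¬ (¬ x ∧ ¬ y) ≡ x ∨ y
    ¬[¬x∧¬y]≡x∨y x y = trans (cong ¬_ (sym (deMorgan₂ x y))) (¬-involutive (x ∨ y))

  squeezed-△ : ∀ {f g x y} → Squeezed f x → Squeezed g y → Squeezed (λ n → f n △ g n) (x △ y)
  squeezed-△ f⇝x g⇝y =
    squeezed-∨ (squeezed-∧ f⇝x (squeezed-¬ g⇝y)) (squeezed-∧ g⇝y (squeezed-¬ f⇝x))

module SequentialTopology {a : Level} (B : CompleteBooleanAlgebra a) where
  open CompleteBooleanAlgebra B renaming (_≤_ to infix 4 _≤_)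
  open Order B
  open AlgebraicLimits B

  Eventually : Pred ℕ a → Set a
  Eventually P = ∃[ k ] (∀ n → n ≥ k → P n)

  eventually-map : ∀ {P Q : Pred ℕ a} → P ⊆ Q → Eventually P → Eventually Q
  eventually-map P⊆Q (k , P-from-k) = k , λ n n≥k → P⊆Q (P-from-k n n≥k)

  eventually-× : ∀ {P Q : Pred ℕ a} → Eventually P → Eventually Q → Eventually (λ n → P n × Q n)
  eventually-× (k , P-from-k) (j , Q-from-j) =
    k ⊔ j , λ n n≥k⊔j → P-from-k n (ℕ.≤-trans (m≤m⊔n k j) n≥k⊔j) ,
                        Q-from-j n (ℕ.≤-trans (m≤n⊔m k j) n≥k⊔j)

  SequentiallyOpen : Pred Carrier a → Set a
  SequentiallyOpen O = ∀ b z → AlgConverges b z → O z → Eventually (λ n → O (b n))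

  sequentiallyOpen-isTopology : IsTopology SequentiallyOpen
  sequentiallyOpen-isTopology = record
    { univ-open = λ b _ _ _ → 0 , λ n _ → b n
    ; ∪-open = λ _ _ U-open b z b→z (i , z∈Uᵢ) → eventually-map (i ,_) (U-open i b z b→z z∈Uᵢ)
    ; ∩-open = λ _ _ U-open V-open b z b→z (z∈U , z∈V) →
        eventually-× (U-open b z b→z z∈U) (V-open b z b→z z∈V)
    ; ≐-open = λ _ _ (U⊆V , V⊆U) U-open b z b→z z∈V → eventually-map U⊆V (U-open b z b→z (V⊆U z∈V))
    }

  isOpen⇒sequentiallyOpen : ∀ {O} → IsOpen O → SequentiallyOpen O
  isOpen⇒sequentiallyOpen (_ , (_ , admissible) , O∈T) b z b→z = admissible b z b→z _ O∈T

  sequentiallyOpen⇒isOpen : ∀ {O} → SequentiallyOpen O → IsOpen O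
  sequentiallyOpen⇒isOpen O-open =
    SequentiallyOpen , (sequentiallyOpen-isTopology , λ b z b→z U U-open → U-open b z b→z) , O-open

  △-preimage-open : ∀ {O} x → IsOpen O → IsOpen (λ y → O (y △ x))
  △-preimage-open x O-open = sequentiallyOpen⇒isOpen λ b z b→z →
    isOpen⇒sequentiallyOpen O-open _ _
      (squeezed⇒algConverges (squeezed-△ (algConverges⇒squeezed b→z) (squeezed-const x)))

  module Classical (em : ExcludedMiddle (lsuc a)) where

    decide : (P : Set a) → Dec P
    decide P = map′ lower lift em

    stable : {P : Set a} → Stable P
    stable = decidable-stable (decide _)

    ∁-closed : ∀ {O} → IsOpen O → IsClosed (∁ O)
    ∁-closed O-open = sequentiallyOpen⇒isOpen λ b z b→z ¬¬z∈O →
      eventually-map (λ bₙ∈O bₙ∉O → bₙ∉O bₙ∈O) (isOpen⇒sequentiallyOpen O-open b z b→z (stable ¬¬z∈O))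

    downClosed-≤ : ∀ {S : Pred Carrier a} → DownClosed S → ∀ {y d} → y ≤ d → S d → S y
    downClosed-≤ S↓ {y} {d} y≤d d∈S with decide (y ≡ d)
    ... | yes refl = d∈S
    ... | no  y≢d  = S↓ (y≤d , y≢d) d∈S

    cl⊆⋂△ˢ : ∀ A → cl A ⊆ (⋂[ 𝒩₀ ] (λ V → A △ˢ V))
    cl⊆⋂△ˢ A {x} x∈clA V (O , O-open , ⊥∈O , O⊆V) = stable λ x∉A△V →
      x∈clA (∁ (λ y → O (y △ x))) (∁-closed (△-preimage-open x O-open))
        (λ {p} p∈A p△x∈O → x∉A△V (p , p △ x , p∈A , O⊆V p△x∈O , sym (x△[x△y]≡y p x)))
        (subst O (sym (x△x≡⊥ x)) ⊥∈O)

    ⋂△ˢ⊆cl : ∀ A → (⋂[ 𝒩₀ ] (λ V → A △ˢ V)) ⊆ cl A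
    ⋂△ˢ⊆cl A {x} x∈⋂ C C-closed A⊆C = stable λ x∉C →
      let p , v , p∈A , v△x∉C , x≡p△v = x∈⋂ (λ v → Not (C (v △ x)))
            (_ , △-preimage-open x C-closed , (λ ⊥△x∈C → x∉C (subst C (△-identityˡ x) ⊥△x∈C)) , id)
      in v△x∉C (subst C (sym (v△x≡p x≡p△v)) (A⊆C p∈A))
      where
      v△x≡p : ∀ {x p v} → x ≡ p △ v → v △ x ≡ p
      v△x≡p {p = p} {v} refl = trans (cong (v △_) (△-comm p v)) (x△[x△y]≡y v p)

    △ˢ⊆∨ˢ : ∀ {A V} → DownClosed A → DownClosed V → A △ˢ V ⊆ A ∨ˢ V
    △ˢ⊆∨ˢ A↓ V↓ {x} (p , v , p∈A , v∈V , x≡p△v) =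
      p ∧ x , ¬ p ∧ x , downClosed-≤ A↓ (x∧y≤x p x) p∈A ,
      downClosed-≤ V↓ (≤∨⇒¬∧≤ (≤-trans (≤-reflexive x≡p△v) (x△y≤x∨y p v))) v∈V , x≡[c∧x]∨[¬c∧x] p x

    cl⊆⋂∨ˢ : ∀ A → DownClosed A → cl A ⊆ (⋂[ 𝒩₀ᵈ ] (λ V → A ∨ˢ V))
    cl⊆⋂∨ˢ A A↓ x∈clA V (V∈𝒩₀ , V↓) = △ˢ⊆∨ˢ A↓ V↓ (cl⊆⋂△ˢ A x∈clA V V∈𝒩₀)

    ⋂∨ˢ⊆cl : ∀ A → DownClosed A → (⋂[ 𝒩₀ᵈ ] (λ V → A ∨ˢ V)) ⊆ cl A
    ⋂∨ˢ⊆cl A A↓ {x} x∈⋂ C C-closed A⊆C = stable λ x∉C →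
      let V∈𝒩₀ᵈ : 𝒩₀ᵈ V
          V∈𝒩₀ᵈ = (V , V-open , (x , ≤-refl , x≤¬⊥ x , x∉C) , id) , V↓
          p , v , p∈A , (u , u≤x , u≤¬v , u∉C) , x≡p∨v = x∈⋂ V V∈𝒩₀ᵈ
          u≤p = ≤-trans (∧-greatest u≤¬v u≤x) (≤∨⇒¬∧≤ (≤-reflexive (trans x≡p∨v (∨-comm p v))))
      in u∉C (A⊆C (downClosed-≤ A↓ u≤p p∈A))
      where
      V : Pred Carrier a
      V v = ∃[ u ] (u ≤ x × u ≤ ¬ v × Not (C u))

      V↓ : DownClosed V
      V↓ (v′≤v , _) (u , u≤x , u≤¬v , u∉C) = u , u≤x , ≤-trans u≤¬v (¬-antimono-≤ v′≤v) , u∉C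

      -- u ≤ ¬ z says exactly that u ∧ ¬ z ≡ u, so u ∧ ¬ bₙ → u ∉ C.
      V-open : IsOpen V
      V-open = sequentiallyOpen⇒isOpen λ { b z b→z (u , u≤x , u≤¬z , u∉C) →
        eventually-map (λ {n} u∧¬bₙ∉C → u ∧ ¬ b n , ≤-trans (x∧y≤x u _) u≤x , x∧y≤y u _ , u∧¬bₙ∉C)
          (isOpen⇒sequentiallyOpen C-closed (λ n → u ∧ ¬ b n) u
            (squeezed⇒algConverges (subst (Squeezed _) u≤¬z
              (squeezed-∧ (squeezed-const u) (squeezed-¬ (algConverges⇒squeezed b→z)))))
            u∉C) }

    ∨ˢ-downClosed : ∀ {A V} → DownClosed A → DownClosed V → DownClosed (A ∨ˢ V)
    ∨ˢ-downClosed A↓ V↓ {y} (y≤x , _) (p , v , p∈A , v∈V , x≡p∨v) =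
      y ∧ p , y ∧ v , downClosed-≤ A↓ (x∧y≤y y p) p∈A , downClosed-≤ V↓ (x∧y≤y y v) v∈V ,
      trans (sym y≤x) (trans (cong (y ∧_) x≡p∨v) (∧-distribˡ-∨ y p v))

    cl-downClosed : ∀ A → DownClosed A → DownClosed (cl A)
    cl-downClosed A A↓ y<x x∈clA =
      ⋂∨ˢ⊆cl A A↓ (λ V (V∈𝒩₀ , V↓) → ∨ˢ-downClosed A↓ V↓ y<x (cl⊆⋂∨ˢ A A↓ x∈clA V (V∈𝒩₀ , V↓)))

lemma3p6 : ∀ {a : Level} → ExcludedMiddle (lsuc a) → (B : CompleteBooleanAlgebra a) →
    let open CompleteBooleanAlgebra B in
      (∀ (A : Pred Carrier a) → cl A ≐ (⋂[ 𝒩₀ ] (λ V → A △ˢ V)))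
      × (Frechet → ∀ (A : Pred Carrier a) → DownClosed A →
          (cl A ≐ (⋂[ 𝒩₀ᵈ ] (λ V → A ∨ˢ V))) × DownClosed (cl A))
lemma3p6 em B =
  (λ A → cl⊆⋂△ˢ A , ⋂△ˢ⊆cl A) ,
  (λ _ A A↓ → (cl⊆⋂∨ˢ A A↓ , ⋂∨ˢ⊆cl A A↓) , cl-downClosed A A↓)
  where open SequentialTopology.Classical B em
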